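{- Let $m$, $n$, $h$ be non-negative integers and $r$ any integer, and assume $V_h\ne0$. Then \[ \begin{split} \sum_{k = 1}^n \frac{k^m w_{hk + r} }{V_h^k } &= - w_r \delta _{m,0} - \frac{n^m w_{h(n + 2) + r} }{q^h V_h^n } + \left( \frac{V_h }{q^h } \right)^{m + 1} \sum_{j = 0}^m A(m,j)\frac{w_{h(j + m + 1) + r} }{V_h^j }\\ &\qquad - \sum_{s = 1}^m \binom ms\frac{n^{m - s} }{q^{h(s + 1)} }\sum_{j = 1}^s A(s,j)\frac{w_{h(j + n + s + 1) + r} }{V_h^{j + n - s - 1}} . \end{split} \]
   Context: Let $a,b,p,q$ be complex numbers with $p\ne0$, $q\ne0$ and $p\ne q+1$. The Horadam sequence $(w_j)=(w_j(a,b;p,q))$ is defined by $w_0=a$, $w_1=b$, $w_j=pw_{j-1}-qw_{j-2}$ for $j\ge2$, extended to negative indices by $w_{ -j}=(pw_{ -j+1}-w_{ -j+2})/q$. $(V_j)=(w_j(2,p;p,q))$ is the Lucas sequence of the second kind, i.e. $V_j=\tau^j+\sigma^j$ where $\tau,\sigma$ are the roots of $x^2=px-q$. $\delta_{m,0}$ is the Kronecker delta. The Eulerian numbers are $A(i,j)=\sum_{t=0}^j(-1)^t\binom{i+1}{t}(j-t)^i$ for non-negative integers $i,j$, with $0^0=1$. Empty sums are $0$. -}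

module Defs where

open import Level using (Level; _⊔_)
open import Algebra.Bundles using (CommutativeRing)
open import Data.Nat as ℕ using (ℕ; zero; suc)
open import Data.Nat.Combinatorics using (_C_)
open import Data.Integer as ℤ using (ℤ; +_; -[1+_])
open import Data.Product using (_×_; _,_; proj₁)
open import Relation.Nullary using (¬_)

-- A field: a commutative ring with 0 ≠ 1 in which every nonzero element
-- has a multiplicative inverse (the inverse function is total; its value
-- at 0 is irrelevant).
record Field (c ℓ : Level) : Set (Level.suc (c ⊔ ℓ)) where
  field
    commutativeRing : CommutativeRing c ℓ
  open CommutativeRing commutativeRing public
  field
    _⁻¹        : Carrier → Carrier
    inverseʳ   : ∀ x → ¬ (x ≈ 0#) → (x * (x ⁻¹)) ≈ 1#
    nontrivial : ¬ (0# ≈ 1#)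
  infix 8 _⁻¹

signℤ : ℕ → ℤ
signℤ zero = + 1
signℤ (suc t) = ℤ.- signℤ t

sumℤ : ℕ → (ℕ → ℤ) → ℤ
sumℤ zero f = + 0
sumℤ (suc n) f = sumℤ n f ℤ.+ f n

Eulerian : ℕ → ℕ → ℤ
Eulerian i j = sumℤ (suc j) (λ t → signℤ t ℤ.* (+ ((suc i C t) ℕ.* ((j ℕ.∸ t) ℕ.^ i))))

module Horadam {c ℓ : Level} (F : Field c ℓ) where
  open Field F

  _^_ : Carrier → ℕ → Carrier
  x ^ zero = 1#
  x ^ suc n = (x ^ n) * x

  _^ℤ_ : Carrier → ℤ → Carrier
  x ^ℤ (+ n) = x ^ n
  x ^ℤ -[1+ n ] = (x ⁻¹) ^ suc n

  fromℕ : ℕ → Carrier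
  fromℕ zero = 0#
  fromℕ (suc n) = fromℕ n + 1#

  fromℤ : ℤ → Carrier
  fromℤ (+ n) = fromℕ n
  fromℤ -[1+ n ] = - fromℕ (suc n)

  -- Σ_{k = lo}^{hi} f k  (empty, i.e. 0, if hi < lo)
  sumFirst : ℕ → (ℕ → Carrier) → Carrier
  sumFirst zero f = 0#
  sumFirst (suc n) f = sumFirst n f + f n

  sumFromTo : ℕ → ℕ → (ℕ → Carrier) → Carrier
  sumFromTo lo hi f = sumFirst (suc hi ℕ.∸ lo) (λ i → f (lo ℕ.+ i))

  δ0 : ℕ → Carrier
  δ0 zero = 1#
  δ0 (suc _) = 0#

  module _ (a b p q : Carrier) where
    -- (w_j , w_{j+1}) for j ≥ 0
    fwd : ℕ → Carrier × Carrier
    fwd zero = a , b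
    fwd (suc j) with fwd j
    ... | x , y = y , (p * y - q * x)

    -- (w_{-j} , w_{-j+1}) for j ≥ 0, using w_{-j} = (p w_{-j+1} - w_{-j+2}) / q
    bwd : ℕ → Carrier × Carrier
    bwd zero = a , b
    bwd (suc j) with bwd j
    ... | x , y = ((p * x - y) * (q ⁻¹)) , x

    w : ℤ → Carrier
    w (+ n) = proj₁ (fwd n)
    w -[1+ n ] = proj₁ (bwd (suc n))

  V : Carrier → Carrier → ℤ → Carrier
  V p q = w (1# + 1#) p p q

{-# OPTIONS --safe #-}
-- Write a k = w (h k + r) / V_h ^ k.  Since w (j + 2h) = V_h w (j + h) - q ^ h w j, the sequence obeys
-- a k = κ (a (k+1) - a (k+2)) with κ = V_h ^ 2 / q ^ h, and the theorem is about the sums Σ k ^ m a k of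
-- any such sequence.  With M = m + 1, iterating the recurrence gives a n = κ ^ M Σ_t (-1)^t C(M,t) a (n+M+t);
-- as M-th differences kill polynomials of degree m, the function
--   G n = κ ^ M Σ_{j ≤ m} b_n(j) a (n+M+j),   b_n(j) = Σ_{t ≤ j} (-1)^t C(M,t) (j - t + n) ^ m,
-- satisfies G n - G (n+1) = n ^ m a n, so the sum telescopes.  Expanding (j - t + n) ^ m binomially
-- writes G n through κ ^ M Σ_j B_M(s,j) a (n+M+j) with B_M(s,j) = Σ_{t ≤ j} (-1)^t C(M,t) (j - t) ^ s;
-- summation by parts shows that this does not depend on M ≥ s + 1, and B_{s+1}(s,j) = A(s,j).
module Submission where

open import Defs
open import Level using (Level)
open import Data.Nat using (ℕ; zero; suc; _∸_; _<_; _≤_; s≤s) renaming (_+_ to _+ℕ_; _*_ to _*ℕ_; _^_ to _^ℕ_)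
open import Data.Nat.Combinatorics using (_C_; nCk+nC[k+1]≡[n+1]C[k+1]; nCn≡1)
open import Data.Nat.Combinatorics.Specification using (k>n⇒nCk≡0)
import Data.Nat.Properties as ℕP
import Data.Nat.Tactic.RingSolver as ℕ-Solver
open import Data.Integer using (ℤ; +_; -[1+_]; _⊖_) renaming (_+_ to _+ℤ_; _*_ to _*ℤ_; _-_ to _-ℤ_)
import Data.Integer as ℤ
import Data.Integer.Properties as ℤP
open import Data.Maybe using (Maybe; just; nothing)
open import Relation.Nullary using (¬_; yes; no)
import Relation.Binary.PropositionalEquality as P
import Algebra.Solver.Ring.AlmostCommutativeRing as ACR
import Algebra.Solver.Ring
import Algebra.Properties.CommutativeSemigroup as CommutativeSemigroupProperties

module Arithmetic {c ℓ : Level} (F : Field c ℓ) where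
  open Field F
  open Horadam F
  open import Relation.Binary.Reasoning.Setoid setoid public
  open import Algebra.Properties.Ring ring public
    using (-‿distribˡ-*; -‿distribʳ-*; -‿+-comm; -‿involutive; -0#≈0#)
  open CommutativeSemigroupProperties +-commutativeSemigroup public
    using () renaming (interchange to +-interchange)
  open CommutativeSemigroupProperties *-commutativeSemigroup public
    using () renaming (interchange to *-interchange; x∙yz≈y∙xz to x*[y*z]≈y*[x*z]; xy∙z≈xz∙y to [x*y]*z≈[x*z]*y)

  ≡⇒≈ : ∀ {x y} → x P.≡ y → x ≈ y
  ≡⇒≈ P.refl = refl

  x-y≈[x+z]-[y+z] : ∀ x y z → x - y ≈ (x + z) - (y + z)
  x-y≈[x+z]-[y+z] x y z = begin
    x - y                   ≈⟨ sym (+-identityʳ _) ⟩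
    (x - y) + 0#            ≈⟨ +-congˡ (sym (-‿inverseʳ z)) ⟩
    (x - y) + (z - z)       ≈⟨ +-interchange x (- y) z (- z) ⟩
    (x + z) + (- y + - z)   ≈⟨ +-congˡ (-‿+-comm y z) ⟩
    (x + z) - (y + z)       ∎

  x*-1≈-x : ∀ x → x * - 1# ≈ - x
  x*-1≈-x x = trans (sym (-‿distribʳ-* x 1#)) (-‿cong (*-identityʳ x))

  fromℕ-1 : fromℕ 1 ≈ 1#
  fromℕ-1 = +-identityˡ 1#

  fromℕ-+ : ∀ m n → fromℕ (m +ℕ n) ≈ fromℕ m + fromℕ n
  fromℕ-+ zero    n = sym (+-identityˡ _)
  fromℕ-+ (suc m) n = begin
    fromℕ (m +ℕ n) + 1#        ≈⟨ +-congʳ (fromℕ-+ m n) ⟩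
    (fromℕ m + fromℕ n) + 1#   ≈⟨ +-assoc _ _ _ ⟩
    fromℕ m + (fromℕ n + 1#)   ≈⟨ +-congˡ (+-comm _ _) ⟩
    fromℕ m + (1# + fromℕ n)   ≈⟨ sym (+-assoc _ _ _) ⟩
    (fromℕ m + 1#) + fromℕ n   ∎

  fromℕ-* : ∀ m n → fromℕ (m *ℕ n) ≈ fromℕ m * fromℕ n
  fromℕ-* zero    n = sym (zeroˡ _)
  fromℕ-* (suc m) n = begin
    fromℕ (n +ℕ m *ℕ n)              ≈⟨ fromℕ-+ n (m *ℕ n) ⟩
    fromℕ n + fromℕ (m *ℕ n)         ≈⟨ +-cong (sym (*-identityˡ _)) (fromℕ-* m n) ⟩
    1# * fromℕ n + fromℕ m * fromℕ n ≈⟨ +-comm _ _ ⟩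
    fromℕ m * fromℕ n + 1# * fromℕ n ≈⟨ sym (distribʳ _ _ _) ⟩
    (fromℕ m + 1#) * fromℕ n         ∎

  fromℕ-∸ : ∀ m n → n ≤ m → fromℕ (m ∸ n) ≈ fromℕ m - fromℕ n
  fromℕ-∸ m       zero    _         = sym (trans (+-congˡ -0#≈0#) (+-identityʳ _))
  fromℕ-∸ (suc m) (suc n) (s≤s n≤m) = trans (fromℕ-∸ m n n≤m) (x-y≈[x+z]-[y+z] _ _ 1#)

  fromℤ-⊖ : ∀ m n → fromℤ (m ⊖ n) ≈ fromℕ m - fromℕ n
  fromℤ-⊖ zero    zero    = sym (-‿inverseʳ 0#)
  fromℤ-⊖ (suc m) zero    = sym (trans (+-congˡ -0#≈0#) (+-identityʳ _))
  fromℤ-⊖ zero    (suc n) = sym (+-identityˡ _)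
  fromℤ-⊖ (suc m) (suc n) = begin
    fromℤ (suc m ⊖ suc n)              ≈⟨ ≡⇒≈ (P.cong fromℤ (ℤP.[1+m]⊖[1+n]≡m⊖n m n)) ⟩
    fromℤ (m ⊖ n)                      ≈⟨ fromℤ-⊖ m n ⟩
    fromℕ m - fromℕ n                  ≈⟨ x-y≈[x+z]-[y+z] (fromℕ m) (fromℕ n) 1# ⟩
    (fromℕ m + 1#) - (fromℕ n + 1#)    ∎

  fromℤ-+ : ∀ i j → fromℤ (i +ℤ j) ≈ fromℤ i + fromℤ j
  fromℤ-+ (+ m)    (+ n)    = fromℕ-+ m n
  fromℤ-+ (+ m)    -[1+ n ] = fromℤ-⊖ m (suc n)
  fromℤ-+ -[1+ m ] (+ n)    = trans (fromℤ-⊖ n (suc m)) (+-comm _ _)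
  fromℤ-+ -[1+ m ] -[1+ n ] = begin
    - (fromℕ (suc (m +ℕ n)) + 1#)      ≈⟨ -‿cong (+-congʳ (≡⇒≈ (P.cong fromℕ (P.sym (ℕP.+-suc m n))))) ⟩
    - (fromℕ (m +ℕ suc n) + 1#)        ≈⟨ -‿cong (+-congʳ (fromℕ-+ m (suc n))) ⟩
    - ((fromℕ m + fromℕ (suc n)) + 1#) ≈⟨ -‿cong (trans (+-assoc _ _ _) (trans (+-congˡ (+-comm _ _)) (sym (+-assoc _ _ _)))) ⟩
    - (fromℕ (suc m) + fromℕ (suc n))  ≈⟨ sym (-‿+-comm _ _) ⟩
    - fromℕ (suc m) + - fromℕ (suc n)  ∎

  fromℤ-neg : ∀ i → fromℤ (ℤ.- i) ≈ - fromℤ i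
  fromℤ-neg (+ zero)  = sym -0#≈0#
  fromℤ-neg (+ suc n) = refl
  fromℤ-neg -[1+ n ]  = sym (-‿involutive _)

  fromℤ-pos-* : ∀ m j → fromℤ (+ m *ℤ j) ≈ fromℕ m * fromℤ j
  fromℤ-pos-* m (+ n)    = trans (≡⇒≈ (P.cong fromℤ (P.sym (ℤP.pos-* m n)))) (fromℕ-* m n)
  fromℤ-pos-* m -[1+ n ] = begin
    fromℤ (+ m *ℤ ℤ.- (+ suc n))    ≈⟨ ≡⇒≈ (P.cong fromℤ (P.sym (ℤP.neg-distribʳ-* (+ m) (+ suc n)))) ⟩
    fromℤ (ℤ.- (+ m *ℤ + suc n))    ≈⟨ fromℤ-neg (+ m *ℤ + suc n) ⟩
    - fromℤ (+ m *ℤ + suc n)       ≈⟨ -‿cong (fromℤ-pos-* m (+ suc n)) ⟩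
    - (fromℕ m * fromℕ (suc n))    ≈⟨ -‿distribʳ-* _ _ ⟩
    fromℕ m * - fromℕ (suc n)      ∎

  fromℤ-* : ∀ i j → fromℤ (i *ℤ j) ≈ fromℤ i * fromℤ j
  fromℤ-* (+ m)    j = fromℤ-pos-* m j
  fromℤ-* -[1+ m ] j = begin
    fromℤ (ℤ.- (+ suc m) *ℤ j)      ≈⟨ ≡⇒≈ (P.cong fromℤ (P.sym (ℤP.neg-distribˡ-* (+ suc m) j))) ⟩
    fromℤ (ℤ.- (+ suc m *ℤ j))      ≈⟨ fromℤ-neg (+ suc m *ℤ j) ⟩
    - fromℤ (+ suc m *ℤ j)         ≈⟨ -‿cong (fromℤ-pos-* (suc m) j) ⟩
    - (fromℕ (suc m) * fromℤ j)    ≈⟨ -‿distribˡ-* _ _ ⟩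
    - fromℕ (suc m) * fromℤ j      ∎

  -- Integer coefficients, so that the solver compares normal forms by computation.
  private
    fromℤ-morphism : ℤ.+-*-rawRing ACR.-Raw-AlmostCommutative⟶ ACR.fromCommutativeRing commutativeRing
    fromℤ-morphism = record
      { ⟦_⟧ = fromℤ ; +-homo = fromℤ-+ ; *-homo = fromℤ-* ; -‿homo = fromℤ-neg
      ; 0-homo = refl ; 1-homo = fromℕ-1 }

    fromℤ-≟ : ∀ i j → Maybe (fromℤ i ≈ fromℤ j)
    fromℤ-≟ i j with i ℤ.≟ j
    ... | yes P.refl = just refl
    ... | no _       = nothing

  open Algebra.Solver.Ring ℤ.+-*-rawRing (ACR.fromCommutativeRing commutativeRing) fromℤ-morphism fromℤ-≟ public
    using (solve; _:=_; _:+_; _:*_; :-_; _:-_)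

  sumFirst-cong : ∀ n {f g : ℕ → Carrier} → (∀ i → f i ≈ g i) → sumFirst n f ≈ sumFirst n g
  sumFirst-cong zero    f≈g = refl
  sumFirst-cong (suc n) f≈g = +-cong (sumFirst-cong n f≈g) (f≈g n)

  sumFirst-cong< : ∀ n {f g : ℕ → Carrier} → (∀ i → i < n → f i ≈ g i) → sumFirst n f ≈ sumFirst n g
  sumFirst-cong< zero    f≈g = refl
  sumFirst-cong< (suc n) f≈g =
    +-cong (sumFirst-cong< n (λ i i<n → f≈g i (ℕP.m<n⇒m<1+n i<n))) (f≈g n ℕP.≤-refl)

  sumFirst-0 : ∀ n → sumFirst n (λ _ → 0#) ≈ 0#
  sumFirst-0 zero    = refl
  sumFirst-0 (suc n) = trans (+-identityʳ _) (sumFirst-0 n)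

  sumFirst-+ : ∀ n (f g : ℕ → Carrier) → sumFirst n (λ i → f i + g i) ≈ sumFirst n f + sumFirst n g
  sumFirst-+ zero    f g = sym (+-identityˡ 0#)
  sumFirst-+ (suc n) f g = trans (+-congʳ (sumFirst-+ n f g)) (+-interchange _ _ _ _)

  sumFirst-neg : ∀ n (f : ℕ → Carrier) → sumFirst n (λ i → - f i) ≈ - sumFirst n f
  sumFirst-neg zero    f = sym -0#≈0#
  sumFirst-neg (suc n) f = trans (+-congʳ (sumFirst-neg n f)) (-‿+-comm _ _)

  sumFirst-- : ∀ n (f g : ℕ → Carrier) → sumFirst n (λ i → f i - g i) ≈ sumFirst n f - sumFirst n g
  sumFirst-- n f g = trans (sumFirst-+ n f (λ i → - g i)) (+-congˡ (sumFirst-neg n g))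

  sumFirst-*ˡ : ∀ n x (f : ℕ → Carrier) → sumFirst n (λ i → x * f i) ≈ x * sumFirst n f
  sumFirst-*ˡ zero    x f = sym (zeroʳ x)
  sumFirst-*ˡ (suc n) x f = trans (+-congʳ (sumFirst-*ˡ n x f)) (sym (distribˡ x _ _))

  sumFirst-*ʳ : ∀ n x (f : ℕ → Carrier) → sumFirst n (λ i → f i * x) ≈ sumFirst n f * x
  sumFirst-*ʳ n x f = trans (sumFirst-cong n (λ i → *-comm (f i) x)) (trans (sumFirst-*ˡ n x f) (*-comm x _))

  sumFirst-unfoldˡ : ∀ n (f : ℕ → Carrier) → sumFirst (suc n) f ≈ f 0 + sumFirst n (λ i → f (suc i))
  sumFirst-unfoldˡ zero    f = trans (+-identityˡ (f 0)) (sym (+-identityʳ (f 0)))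
  sumFirst-unfoldˡ (suc n) f = trans (+-congʳ (sumFirst-unfoldˡ n f)) (+-assoc _ _ _)

  sumFirst-comm : ∀ n k (f : ℕ → ℕ → Carrier) →
    sumFirst n (λ i → sumFirst k (f i)) ≈ sumFirst k (λ j → sumFirst n (λ i → f i j))
  sumFirst-comm zero    k f = sym (sumFirst-0 k)
  sumFirst-comm (suc n) k f = trans (+-congʳ (sumFirst-comm n k f)) (sym (sumFirst-+ k _ (f n)))

  sumFirst-by-parts : ∀ l (β g : ℕ → Carrier) →
    β 0 * g 0 + sumFirst l (λ j → (β (suc j) - β j) * g (suc j))
      ≈ (sumFirst l (λ j → β j * g j) + β l * g l) - sumFirst l (λ j → β j * g (suc j))
  sumFirst-by-parts zero    β g =
    trans (+-identityʳ _) (sym (trans (+-congˡ -0#≈0#) (trans (+-identityʳ _) (+-identityˡ _))))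
  sumFirst-by-parts (suc l) β g = begin
    β 0 * g 0 + (sumFirst l (λ j → (β (suc j) - β j) * g (suc j)) + (β (suc l) - β l) * g (suc l))
      ≈⟨ trans (sym (+-assoc _ _ _)) (+-congʳ (sumFirst-by-parts l β g)) ⟩
    ((S + β l * g l) - S′) + (β (suc l) - β l) * g (suc l)
      ≈⟨ solve 6 (λ s x s′ b′ b g → ((s :+ x) :- s′) :+ (b′ :- b) :* g := ((s :+ x) :+ b′ :* g) :- (s′ :+ b :* g))
               refl S (β l * g l) S′ (β (suc l)) (β l) (g (suc l)) ⟩
    ((S + β l * g l) + β (suc l) * g (suc l)) - (S′ + β l * g (suc l)) ∎
    where
    S S′ : Carrier
    S = sumFirst l (λ j → β j * g j)
    S′ = sumFirst l (λ j → β j * g (suc j))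

  ^-cong : ∀ {x y} n → x ≈ y → x ^ n ≈ y ^ n
  ^-cong zero    x≈y = refl
  ^-cong (suc n) x≈y = *-cong (^-cong n x≈y) x≈y

  ^-distribˡ-+-* : ∀ x m n → x ^ (m +ℕ n) ≈ x ^ m * x ^ n
  ^-distribˡ-+-* x zero    n = sym (*-identityˡ _)
  ^-distribˡ-+-* x (suc m) n = begin
    x ^ (m +ℕ n) * x      ≈⟨ *-congʳ (^-distribˡ-+-* x m n) ⟩
    (x ^ m * x ^ n) * x   ≈⟨ [x*y]*z≈[x*z]*y (x ^ m) (x ^ n) x ⟩
    (x ^ m * x) * x ^ n   ∎

  ^-distribʳ-* : ∀ x y n → (x * y) ^ n ≈ x ^ n * y ^ n
  ^-distribʳ-* x y zero    = sym (*-identityˡ 1#)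
  ^-distribʳ-* x y (suc n) = begin
    (x * y) ^ n * (x * y)       ≈⟨ *-congʳ (^-distribʳ-* x y n) ⟩
    (x ^ n * y ^ n) * (x * y)   ≈⟨ *-interchange (x ^ n) (y ^ n) x y ⟩
    (x ^ n * x) * (y ^ n * y)   ∎

  ^-*-assoc : ∀ x m n → x ^ (m *ℕ n) ≈ (x ^ m) ^ n
  ^-*-assoc x m zero    = ≡⇒≈ (P.cong (x ^_) (ℕP.*-zeroʳ m))
  ^-*-assoc x m (suc n) = begin
    x ^ (m *ℕ suc n)        ≈⟨ ≡⇒≈ (P.cong (x ^_) (P.trans (ℕP.*-suc m n) (ℕP.+-comm m (m *ℕ n)))) ⟩
    x ^ (m *ℕ n +ℕ m)       ≈⟨ ^-distribˡ-+-* x (m *ℕ n) m ⟩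
    x ^ (m *ℕ n) * x ^ m    ≈⟨ *-congʳ (^-*-assoc x m n) ⟩
    (x ^ m) ^ n * x ^ m     ∎

  1^n≈1 : ∀ n → 1# ^ n ≈ 1#
  1^n≈1 zero    = refl
  1^n≈1 (suc n) = trans (*-identityʳ _) (1^n≈1 n)

  fromℕ-^ : ∀ m n → fromℕ (m ^ℕ n) ≈ fromℕ m ^ n
  fromℕ-^ m zero    = fromℕ-1
  fromℕ-^ m (suc n) = trans (fromℕ-* m (m ^ℕ n)) (trans (*-comm _ _) (*-congʳ (fromℕ-^ m n)))

  0^m*x≈x*δ0 : ∀ m x → fromℕ 0 ^ m * x ≈ x * δ0 m
  0^m*x≈x*δ0 zero    x = *-comm _ _
  0^m*x≈x*δ0 (suc m) x = trans (*-congʳ (zeroʳ _)) (trans (zeroˡ _) (sym (zeroʳ _)))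

  *≈1⇒≢0 : ∀ {x y} → x * y ≈ 1# → ¬ (x ≈ 0#)
  *≈1⇒≢0 {x} {y} xy≈1 x≈0 = nontrivial (begin
    0#      ≈⟨ sym (zeroˡ y) ⟩
    0# * y  ≈⟨ *-congʳ (sym x≈0) ⟩
    x * y   ≈⟨ xy≈1 ⟩
    1#      ∎)

  ⁻¹-unique : ∀ {x y} → x * y ≈ 1# → x ⁻¹ ≈ y
  ⁻¹-unique {x} {y} xy≈1 = begin
    x ⁻¹              ≈⟨ sym (*-identityʳ _) ⟩
    x ⁻¹ * 1#         ≈⟨ *-congˡ (sym xy≈1) ⟩
    x ⁻¹ * (x * y)    ≈⟨ sym (*-assoc _ _ _) ⟩
    (x ⁻¹ * x) * y    ≈⟨ *-congʳ (trans (*-comm _ _) (inverseʳ x (*≈1⇒≢0 xy≈1))) ⟩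
    1# * y            ≈⟨ *-identityˡ y ⟩
    y                 ∎

  ⁻¹-cong : ∀ {x y} → x ≈ y → ¬ (y ≈ 0#) → x ⁻¹ ≈ y ⁻¹
  ⁻¹-cong {y = y} x≈y y≢0 = ⁻¹-unique (trans (*-congʳ x≈y) (inverseʳ y y≢0))

  ^-inverseʳ : ∀ {x} → ¬ (x ≈ 0#) → ∀ n → x ^ n * (x ⁻¹) ^ n ≈ 1#
  ^-inverseʳ {x} x≢0 n = trans (sym (^-distribʳ-* x (x ⁻¹) n)) (trans (^-cong n (inverseʳ x x≢0)) (1^n≈1 n))

  ^-≢0 : ∀ {x} → ¬ (x ≈ 0#) → ∀ n → ¬ (x ^ n ≈ 0#)
  ^-≢0 x≢0 n = *≈1⇒≢0 (^-inverseʳ x≢0 n)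

  ⁻¹-^ : ∀ {x} → ¬ (x ≈ 0#) → ∀ n → (x ^ n) ⁻¹ ≈ (x ⁻¹) ^ n
  ⁻¹-^ x≢0 n = ⁻¹-unique (^-inverseʳ x≢0 n)

  ⁻¹-* : ∀ {x y} → ¬ (x ≈ 0#) → ¬ (y ≈ 0#) → (x * y) ⁻¹ ≈ x ⁻¹ * y ⁻¹
  ⁻¹-* {x} {y} x≢0 y≢0 = ⁻¹-unique (begin
    (x * y) * (x ⁻¹ * y ⁻¹)     ≈⟨ *-interchange x y (x ⁻¹) (y ⁻¹) ⟩
    (x * x ⁻¹) * (y * y ⁻¹)     ≈⟨ *-cong (inverseʳ x x≢0) (inverseʳ y y≢0) ⟩
    1# * 1#                     ≈⟨ *-identityˡ 1# ⟩
    1#                          ∎)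

  ^ℤ-⊖-* : ∀ {x} → ¬ (x ≈ 0#) → ∀ m n → x ^ℤ (m ⊖ n) * x ^ n ≈ x ^ m
  ^ℤ-⊖-*     x≢0 m       zero    = *-identityʳ _
  ^ℤ-⊖-*     x≢0 zero    (suc n) = trans (*-comm _ _) (^-inverseʳ x≢0 (suc n))
  ^ℤ-⊖-* {x} x≢0 (suc m) (suc n) = begin
    x ^ℤ (suc m ⊖ suc n) * (x ^ n * x)   ≈⟨ *-congʳ (≡⇒≈ (P.cong (x ^ℤ_) (ℤP.[1+m]⊖[1+n]≡m⊖n m n))) ⟩
    x ^ℤ (m ⊖ n) * (x ^ n * x)           ≈⟨ sym (*-assoc _ _ _) ⟩
    (x ^ℤ (m ⊖ n) * x ^ n) * x           ≈⟨ *-congʳ (^ℤ-⊖-* x≢0 m n) ⟩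
    x ^ m * x                            ∎

  ⁻¹-^ℤ-⊖ : ∀ {x} → ¬ (x ≈ 0#) → ∀ m n → (x ^ℤ (m ⊖ n)) ⁻¹ ≈ x ^ n * (x ⁻¹) ^ m
  ⁻¹-^ℤ-⊖ {x} x≢0 m n = ⁻¹-unique (begin
    x ^ℤ (m ⊖ n) * (x ^ n * (x ⁻¹) ^ m)   ≈⟨ sym (*-assoc _ _ _) ⟩
    (x ^ℤ (m ⊖ n) * x ^ n) * (x ⁻¹) ^ m   ≈⟨ *-congʳ (^ℤ-⊖-* x≢0 m n) ⟩
    x ^ m * (x ⁻¹) ^ m                    ≈⟨ ^-inverseʳ x≢0 m ⟩
    1#                                    ∎)

module FiniteDifferences {c ℓ : Level} (F : Field c ℓ) where
  open Field F
  open Horadam F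
  open Arithmetic F

  sign : ℕ → Carrier
  sign zero    = 1#
  sign (suc t) = - sign t

  choose : ℕ → ℕ → Carrier
  choose m t = fromℕ (m C t)

  choose-suc : ∀ m t → choose (suc m) (suc t) ≈ choose m t + choose m (suc t)
  choose-suc m t = trans (≡⇒≈ (P.cong fromℕ (P.sym (nCk+nC[k+1]≡[n+1]C[k+1] m t)))) (fromℕ-+ (m C t) (m C suc t))

  choose-n-n : ∀ m → choose m m ≈ 1#
  choose-n-n m = trans (≡⇒≈ (P.cong fromℕ (nCn≡1 m))) fromℕ-1

  choose-n-suc-n : ∀ m → choose m (suc m) ≈ 0#
  choose-n-suc-n m = ≡⇒≈ (P.cong fromℕ (k>n⇒nCk≡0 (ℕP.n<1+n m)))

  sumFirst-choose-suc : ∀ m l (g : ℕ → Carrier) →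
    sumFirst (suc l) (λ t → choose (suc m) t * g t)
      ≈ sumFirst (suc l) (λ t → choose m t * g t) + sumFirst l (λ t → choose m t * g (suc t))
  sumFirst-choose-suc m zero    g = sym (+-identityʳ _)
  sumFirst-choose-suc m (suc l) g = begin
    sumFirst (suc l) (λ t → choose (suc m) t * g t) + choose (suc m) (suc l) * g (suc l)
      ≈⟨ +-cong (sumFirst-choose-suc m l g) (*-congʳ (choose-suc m l)) ⟩
    (A + B) + (choose m l + choose m (suc l)) * g (suc l)
      ≈⟨ solve 5 (λ A B x y g → (A :+ B) :+ (x :+ y) :* g := (A :+ y :* g) :+ (B :+ x :* g))
               refl A B (choose m l) (choose m (suc l)) (g (suc l)) ⟩
    (A + choose m (suc l) * g (suc l)) + (B + choose m l * g (suc l)) ∎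
    where
    A B : Carrier
    A = sumFirst (suc l) (λ t → choose m t * g t)
    B = sumFirst l (λ t → choose m t * g (suc t))

  binomial : ∀ n x y → (x + y) ^ n ≈ sumFirst (suc n) (λ i → choose n i * (x ^ i * y ^ (n ∸ i)))
  binomial zero    x y = sym (trans (+-identityˡ _) (trans (*-congʳ fromℕ-1) (trans (*-identityˡ _) (*-identityˡ _))))
  binomial (suc n) x y = sym (begin
    sumFirst (suc (suc n)) (λ i → choose (suc n) i * (x ^ i * y ^ (suc n ∸ i)))
      ≈⟨ sumFirst-choose-suc n (suc n) _ ⟩
    (sumFirst (suc n) (λ i → choose n i * (x ^ i * y ^ (suc n ∸ i))) + choose n (suc n) * (x ^ suc n * y ^ (n ∸ n)))
      + sumFirst (suc n) (λ i → choose n i * ((x ^ i * x) * y ^ (n ∸ i)))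
      ≈⟨ +-cong (trans (+-cong (sumFirst-cong< (suc n) (λ i i<1+n → times-y i (ℕP.≤-pred i<1+n)))
                               (trans (*-congʳ (choose-n-suc-n n)) (zeroˡ _)))
                       (+-identityʳ _))
                (sumFirst-cong (suc n) times-x) ⟩
    sumFirst (suc n) (λ i → T i * y) + sumFirst (suc n) (λ i → T i * x)
      ≈⟨ +-cong (sumFirst-*ʳ (suc n) y T) (sumFirst-*ʳ (suc n) x T) ⟩
    S * y + S * x
      ≈⟨ trans (+-comm _ _) (sym (distribˡ S x y)) ⟩
    S * (x + y)
      ≈⟨ *-congʳ (sym (binomial n x y)) ⟩
    (x + y) ^ n * (x + y) ∎)
    where
    T : ℕ → Carrier
    T i = choose n i * (x ^ i * y ^ (n ∸ i))
    S : Carrier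
    S = sumFirst (suc n) T
    times-y : ∀ i → i ≤ n → choose n i * (x ^ i * y ^ (suc n ∸ i)) ≈ T i * y
    times-y i i≤n = begin
      choose n i * (x ^ i * y ^ (suc n ∸ i))   ≈⟨ *-congˡ (*-congˡ (≡⇒≈ (P.cong (y ^_) (ℕP.+-∸-assoc 1 i≤n)))) ⟩
      choose n i * (x ^ i * (y ^ (n ∸ i) * y))
        ≈⟨ solve 4 (λ c a b y → c :* (a :* (b :* y)) := (c :* (a :* b)) :* y) refl (choose n i) (x ^ i) (y ^ (n ∸ i)) y ⟩
      T i * y                                  ∎
    times-x : ∀ i → choose n i * ((x ^ i * x) * y ^ (n ∸ i)) ≈ T i * x
    times-x i = solve 4 (λ c a x b → c :* ((a :* x) :* b) := (c :* (a :* b)) :* x) refl (choose n i) (x ^ i) x (y ^ (n ∸ i))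

  altSum : ℕ → ℕ → (ℕ → Carrier) → Carrier
  altSum m l g = sumFirst l (λ t → sign t * choose m t * g t)

  -- Δ m g is (-1)^m times the m-th forward difference of g at 0.
  Δ : ℕ → (ℕ → Carrier) → Carrier
  Δ m = altSum m (suc m)

  altSum-cong : ∀ m l {f g : ℕ → Carrier} → (∀ t → f t ≈ g t) → altSum m l f ≈ altSum m l g
  altSum-cong m l f≈g = sumFirst-cong l (λ t → *-congˡ (f≈g t))

  altSum-suc : ∀ m l (g : ℕ → Carrier) →
    altSum (suc m) (suc l) g ≈ altSum m (suc l) g - altSum m l (λ t → g (suc t))
  altSum-suc m zero    g = sym (trans (+-congˡ -0#≈0#) (+-identityʳ _))
  altSum-suc m (suc l) g = begin
    altSum (suc m) (suc l) g + - sign l * choose (suc m) (suc l) * g (suc l)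
      ≈⟨ +-cong (altSum-suc m l g) (*-congʳ (*-congˡ (choose-suc m l))) ⟩
    (A - B) + - sign l * (choose m l + choose m (suc l)) * g (suc l)
      ≈⟨ solve 6 (λ A B s x y g → (A :- B) :+ ((:- s) :* (x :+ y)) :* g := (A :+ ((:- s) :* y) :* g) :- (B :+ (s :* x) :* g))
               refl A B (sign l) (choose m l) (choose m (suc l)) (g (suc l)) ⟩
    altSum m (suc (suc l)) g - altSum m (suc l) (λ t → g (suc t)) ∎
    where
    A B : Carrier
    A = altSum m (suc l) g
    B = altSum m l (λ t → g (suc t))

  Δ-suc : ∀ m (g : ℕ → Carrier) → Δ (suc m) g ≈ Δ m g - Δ m (λ t → g (suc t))
  Δ-suc m g = trans (altSum-suc m (suc m) g) (+-congʳ (trans (+-congˡ top≈0) (+-identityʳ _)))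
    where
    top≈0 : sign (suc m) * choose m (suc m) * g (suc m) ≈ 0#
    top≈0 = trans (*-congʳ (trans (*-congˡ (choose-n-suc-n m)) (zeroʳ _))) (zeroˡ _)

  Δ-shift : ∀ m s u d →
    Δ m (λ t → ((u + d) + fromℕ t * d) ^ s)
      ≈ sumFirst s (λ i → choose s i * d ^ (s ∸ i) * Δ m (λ t → (u + fromℕ t * d) ^ i))
        + Δ m (λ t → (u + fromℕ t * d) ^ s)
  Δ-shift m s u d = begin
    Δ m (λ t → ((u + d) + fromℕ t * d) ^ s)
      ≈⟨ altSum-cong m (suc m) (λ t → trans (^-cong s (solve 3 (λ u d x → (u :+ d) :+ x := (u :+ x) :+ d) refl u d (fromℕ t * d)))
                                            (binomial s (u + fromℕ t * d) d)) ⟩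
    sumFirst (suc m) (λ t → sign t * choose m t * sumFirst (suc s) (λ i → choose s i * (x t ^ i * d ^ (s ∸ i))))
      ≈⟨ sumFirst-cong (suc m) (λ t → sym (sumFirst-*ˡ (suc s) _ _)) ⟩
    sumFirst (suc m) (λ t → sumFirst (suc s) (λ i → sign t * choose m t * (choose s i * (x t ^ i * d ^ (s ∸ i)))))
      ≈⟨ sumFirst-comm (suc m) (suc s) _ ⟩
    sumFirst (suc s) (λ i → sumFirst (suc m) (λ t → sign t * choose m t * (choose s i * (x t ^ i * d ^ (s ∸ i)))))
      ≈⟨ sumFirst-cong (suc s) (λ i → trans (sumFirst-cong (suc m) (λ t → regroup (sign t) (choose m t) (choose s i) (x t ^ i) (d ^ (s ∸ i))))
                                             (sumFirst-*ˡ (suc m) _ _)) ⟩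
    sumFirst s (λ i → choose s i * d ^ (s ∸ i) * Δ m (λ t → x t ^ i)) + choose s s * d ^ (s ∸ s) * Δ m (λ t → x t ^ s)
      ≈⟨ +-congˡ (trans (*-congʳ (trans (*-cong (choose-n-n s) (≡⇒≈ (P.cong (d ^_) (ℕP.n∸n≡0 s)))) (*-identityˡ 1#)))
                        (*-identityˡ _)) ⟩
    sumFirst s (λ i → choose s i * d ^ (s ∸ i) * Δ m (λ t → x t ^ i)) + Δ m (λ t → x t ^ s) ∎
    where
    x : ℕ → Carrier
    x t = u + fromℕ t * d
    regroup : ∀ a b c y e → a * b * (c * (y * e)) ≈ c * e * (a * b * y)
    regroup = solve 5 (λ a b c y e → (a :* b) :* (c :* (y :* e)) := (c :* e) :* ((a :* b) :* y)) refl

  Δ-power-vanishes : ∀ m s u d → s < m → Δ m (λ t → (u + fromℕ t * d) ^ s) ≈ 0#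
  Δ-power-vanishes (suc m) s u d (s≤s s≤m) = begin
    Δ (suc m) (λ t → x t ^ s)
      ≈⟨ Δ-suc m (λ t → x t ^ s) ⟩
    Δ m (λ t → x t ^ s) - Δ m (λ t → (u + fromℕ (suc t) * d) ^ s)
      ≈⟨ +-congˡ (-‿cong (altSum-cong m (suc m) (λ t → ^-cong s (step t)))) ⟩
    Δ m (λ t → x t ^ s) - Δ m (λ t → ((u + d) + fromℕ t * d) ^ s)
      ≈⟨ +-congˡ (-‿cong (trans (Δ-shift m s u d) (+-congʳ lower≈0))) ⟩
    Δ m (λ t → x t ^ s) - (0# + Δ m (λ t → x t ^ s))
      ≈⟨ trans (+-congˡ (-‿cong (+-identityˡ _))) (-‿inverseʳ _) ⟩
    0# ∎
    where
    x : ℕ → Carrier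
    x t = u + fromℕ t * d
    step : ∀ t → u + (fromℕ t + 1#) * d ≈ (u + d) + fromℕ t * d
    step t = trans (solve 4 (λ u n o d → u :+ (n :+ o) :* d := (u :+ o :* d) :+ n :* d) refl u (fromℕ t) 1# d)
                 (+-congʳ (+-congˡ (*-identityˡ d)))
    lower≈0 : sumFirst s (λ i → choose s i * d ^ (s ∸ i) * Δ m (λ t → x t ^ i)) ≈ 0#
    lower≈0 = trans (sumFirst-cong< s (λ i i<s → trans (*-congˡ (Δ-power-vanishes m i u d (ℕP.<-≤-trans i<s s≤m))) (zeroʳ _)))
                    (sumFirst-0 s)

  -- For m = s + 1 this is the Eulerian number A(s, j).
  generalizedEulerian : ℕ → ℕ → ℕ → Carrier
  generalizedEulerian m s j = altSum m (suc j) (λ t → (fromℕ j - fromℕ t) ^ s)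

  generalizedEulerian-at-0 : ∀ m s → generalizedEulerian m (suc s) 0 ≈ 0#
  generalizedEulerian-at-0 m s =
    trans (+-identityˡ _) (trans (*-congˡ (trans (*-congˡ (-‿inverseʳ 0#)) (zeroʳ _))) (zeroʳ _))

  fromℤ-sumℤ : ∀ n f → fromℤ (sumℤ n f) ≈ sumFirst n (λ t → fromℤ (f t))
  fromℤ-sumℤ zero    f = refl
  fromℤ-sumℤ (suc n) f = trans (fromℤ-+ (sumℤ n f) (f n)) (+-congʳ (fromℤ-sumℤ n f))

  fromℤ-signℤ : ∀ t → fromℤ (signℤ t) ≈ sign t
  fromℤ-signℤ zero    = fromℕ-1
  fromℤ-signℤ (suc t) = trans (fromℤ-neg (signℤ t)) (-‿cong (fromℤ-signℤ t))

  fromℤ-Eulerian : ∀ s j → fromℤ (Eulerian s j) ≈ generalizedEulerian (suc s) s j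
  fromℤ-Eulerian s j = trans (fromℤ-sumℤ (suc j) _) (sumFirst-cong< (suc j) term)
    where
    term : ∀ t → t < suc j →
      fromℤ (signℤ t *ℤ + ((suc s C t) *ℕ (j ∸ t) ^ℕ s)) ≈ sign t * choose (suc s) t * (fromℕ j - fromℕ t) ^ s
    term t t<1+j = begin
      fromℤ (signℤ t *ℤ + ((suc s C t) *ℕ (j ∸ t) ^ℕ s))  ≈⟨ fromℤ-* (signℤ t) _ ⟩
      fromℤ (signℤ t) * fromℕ ((suc s C t) *ℕ (j ∸ t) ^ℕ s) ≈⟨ *-cong (fromℤ-signℤ t) (fromℕ-* (suc s C t) _) ⟩
      sign t * (choose (suc s) t * fromℕ ((j ∸ t) ^ℕ s))
        ≈⟨ *-congˡ (*-congˡ (trans (fromℕ-^ (j ∸ t) s) (^-cong s (fromℕ-∸ j t (ℕP.≤-pred t<1+j))))) ⟩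
      sign t * (choose (suc s) t * (fromℕ j - fromℕ t) ^ s) ≈⟨ sym (*-assoc _ _ _) ⟩
      sign t * choose (suc s) t * (fromℕ j - fromℕ t) ^ s   ∎

  generalizedEulerian-suc : ∀ m s j →
    generalizedEulerian (suc m) s (suc j) ≈ generalizedEulerian m s (suc j) - generalizedEulerian m s j
  generalizedEulerian-suc m s j = trans (altSum-suc m (suc j) (λ t → (fromℕ (suc j) - fromℕ t) ^ s))
    (+-congˡ (-‿cong (altSum-cong m (suc j) (λ t → ^-cong s (sym (x-y≈[x+z]-[y+z] (fromℕ j) (fromℕ t) 1#))))))

  generalizedEulerian-top : ∀ m s → s < m → generalizedEulerian m s m ≈ 0#
  generalizedEulerian-top m s s<m =
    trans (altSum-cong m (suc m) (λ t → ^-cong s (+-congˡ (sym (x*-1≈-x (fromℕ t))))))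
          (Δ-power-vanishes m s (fromℕ m) (- 1#) s<m)

module SecondOrderRecurrence {c ℓ : Level} (F : Field c ℓ) where
  open Field F
  open Horadam F
  open Arithmetic F
  open FiniteDifferences F

  module Sums (κ : Carrier) (a : ℕ → Carrier) (a-rec : ∀ k → a k ≈ κ * (a (suc k) - a (suc (suc k)))) where

    a-cong : ∀ {i j} → i P.≡ j → a i ≈ a j
    a-cong i≡j = ≡⇒≈ (P.cong a i≡j)

    weighted-recurrence : ∀ l (w : ℕ → Carrier) n m →
      κ ^ suc m * (sumFirst l (λ t → w t * a (n +ℕ suc m +ℕ t)) - sumFirst l (λ t → w t * a (n +ℕ suc m +ℕ suc t)))
        ≈ κ ^ m * sumFirst l (λ t → w t * a (n +ℕ m +ℕ t))
    weighted-recurrence l w n m = begin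
      κ ^ m * κ * (sumFirst l (λ t → w t * a₁ t) - sumFirst l (λ t → w t * a₂ t))
        ≈⟨ trans (*-assoc _ _ _) (*-congˡ (*-congˡ (sym (sumFirst-- l _ _)))) ⟩
      κ ^ m * (κ * sumFirst l (λ t → w t * a₁ t - w t * a₂ t))
        ≈⟨ *-congˡ (sym (sumFirst-*ˡ l κ _)) ⟩
      κ ^ m * sumFirst l (λ t → κ * (w t * a₁ t - w t * a₂ t))
        ≈⟨ *-congˡ (sumFirst-cong l step) ⟩
      κ ^ m * sumFirst l (λ t → w t * a (n +ℕ m +ℕ t)) ∎
      where
      a₁ a₂ : ℕ → Carrier
      a₁ t = a (n +ℕ suc m +ℕ t)
      a₂ t = a (n +ℕ suc m +ℕ suc t)
      a₁≈ : ∀ t → a₁ t ≈ a (suc (n +ℕ m +ℕ t))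
      a₁≈ t = a-cong (P.cong (_+ℕ t) (ℕP.+-suc n m))
      a₂≈ : ∀ t → a₂ t ≈ a (suc (suc (n +ℕ m +ℕ t)))
      a₂≈ t = a-cong (P.trans (ℕP.+-suc (n +ℕ suc m) t) (P.cong (λ i → suc (i +ℕ t)) (ℕP.+-suc n m)))
      step : ∀ t → κ * (w t * a₁ t - w t * a₂ t) ≈ w t * a (n +ℕ m +ℕ t)
      step t = begin
        κ * (w t * a₁ t - w t * a₂ t)  ≈⟨ solve 4 (λ k w x y → k :* (w :* x :- w :* y) := w :* (k :* (x :- y))) refl κ (w t) (a₁ t) (a₂ t) ⟩
        w t * (κ * (a₁ t - a₂ t))      ≈⟨ *-congˡ (trans (*-congˡ (+-cong (a₁≈ t) (-‿cong (a₂≈ t)))) (sym (a-rec _))) ⟩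
        w t * a (n +ℕ m +ℕ t)          ∎

    a≈κ^m*Δ : ∀ m n → a n ≈ κ ^ m * Δ m (λ t → a (n +ℕ m +ℕ t))
    a≈κ^m*Δ zero    n = sym (begin
      1# * (0# + 1# * fromℕ 1 * a (n +ℕ 0 +ℕ 0))  ≈⟨ trans (*-identityˡ _) (+-identityˡ _) ⟩
      1# * fromℕ 1 * a (n +ℕ 0 +ℕ 0)             ≈⟨ trans (*-congʳ (trans (*-identityˡ _) fromℕ-1)) (*-identityˡ _) ⟩
      a (n +ℕ 0 +ℕ 0)                            ≈⟨ a-cong (P.trans (ℕP.+-identityʳ (n +ℕ 0)) (ℕP.+-identityʳ n)) ⟩
      a n                                        ∎)
    a≈κ^m*Δ (suc m) n = sym (begin
      κ ^ suc m * Δ (suc m) (λ t → a (n +ℕ suc m +ℕ t))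
        ≈⟨ *-congˡ (Δ-suc m _) ⟩
      κ ^ suc m * (Δ m (λ t → a (n +ℕ suc m +ℕ t)) - Δ m (λ t → a (n +ℕ suc m +ℕ suc t)))
        ≈⟨ weighted-recurrence (suc m) (λ t → sign t * choose m t) n m ⟩
      κ ^ m * Δ m (λ t → a (n +ℕ m +ℕ t))
        ≈⟨ sym (a≈κ^m*Δ m n) ⟩
      a n ∎)

    eulerianTail : ℕ → ℕ → ℕ → Carrier
    eulerianTail m s n = κ ^ m * sumFirst m (λ j → generalizedEulerian m s j * a (n +ℕ m +ℕ j))

    eulerianTail-suc : ∀ m s n → s < m → eulerianTail (suc m) s n ≈ eulerianTail m s n
    eulerianTail-suc m s n s<m = begin
      κ ^ suc m * sumFirst (suc m) (λ j → generalizedEulerian (suc m) s j * g j)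
        ≈⟨ *-congˡ (trans (sumFirst-unfoldˡ m _) (+-congˡ (sumFirst-cong m (λ j → *-congʳ (generalizedEulerian-suc m s j))))) ⟩
      κ ^ suc m * (E 0 * g 0 + sumFirst m (λ j → (E (suc j) - E j) * g (suc j)))
        ≈⟨ *-congˡ (sumFirst-by-parts m E g) ⟩
      κ ^ suc m * ((sumFirst m (λ j → E j * g j) + E m * g m) - sumFirst m (λ j → E j * g (suc j)))
        ≈⟨ *-congˡ (+-congʳ (trans (+-congˡ (trans (*-congʳ (generalizedEulerian-top m s s<m)) (zeroˡ _))) (+-identityʳ _))) ⟩
      κ ^ suc m * (sumFirst m (λ j → E j * g j) - sumFirst m (λ j → E j * g (suc j)))
        ≈⟨ weighted-recurrence m E n m ⟩
      eulerianTail m s n ∎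
      where
      E g : ℕ → Carrier
      E j = generalizedEulerian m s j
      g j = a (n +ℕ suc m +ℕ j)

    eulerianTail-stable : ∀ k s n → eulerianTail (k +ℕ suc s) s n ≈ eulerianTail (suc s) s n
    eulerianTail-stable zero    s n = refl
    eulerianTail-stable (suc k) s n = trans (eulerianTail-suc (k +ℕ suc s) s n (ℕP.m≤n+m (suc s) k)) (eulerianTail-stable k s n)

    eulerianTail-1-0 : ∀ n → eulerianTail 1 0 n ≈ κ * a (suc n)
    eulerianTail-1-0 n = *-cong (*-identityˡ κ) (begin
      0# + (0# + 1# * fromℕ 1 * 1#) * a (n +ℕ 1 +ℕ 0)
        ≈⟨ trans (+-identityˡ _) (*-congʳ (trans (+-identityˡ _) (trans (*-identityʳ _) (trans (*-identityˡ _) fromℕ-1)))) ⟩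
      1# * a (n +ℕ 1 +ℕ 0)                            ≈⟨ trans (*-identityˡ _) (a-cong (P.trans (ℕP.+-identityʳ (n +ℕ 1)) (ℕP.+-comm n 1))) ⟩
      a (suc n)                                       ∎)

    module PowerWeightedSums (m : ℕ) where

      antidifferenceWeight : ℕ → ℕ → Carrier
      antidifferenceWeight n j = altSum (suc m) (suc j) (λ t → ((fromℕ j - fromℕ t) + fromℕ n) ^ m)

      antidifference : ℕ → Carrier
      antidifference n = κ ^ suc m * sumFirst (suc m) (λ j → antidifferenceWeight n j * a (n +ℕ suc m +ℕ j))

      antidifferenceWeight-0 : ∀ n → antidifferenceWeight n 0 ≈ fromℕ n ^ m
      antidifferenceWeight-0 n = begin
        0# + 1# * fromℕ 1 * ((fromℕ 0 - fromℕ 0) + fromℕ n) ^ m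
          ≈⟨ trans (+-identityˡ _) (*-congʳ (trans (*-identityˡ _) fromℕ-1)) ⟩
        1# * ((0# - 0#) + fromℕ n) ^ m
          ≈⟨ trans (*-identityˡ _) (^-cong m (trans (+-congʳ (-‿inverseʳ 0#)) (+-identityˡ _))) ⟩
        fromℕ n ^ m ∎

      antidifferenceWeight-top : ∀ n → antidifferenceWeight n (suc m) ≈ 0#
      antidifferenceWeight-top n =
        trans (altSum-cong (suc m) (suc (suc m)) (λ t → ^-cong m (progression t)))
              (Δ-power-vanishes (suc m) m (fromℕ (suc m) + fromℕ n) (- 1#) ℕP.≤-refl)
        where
        progression : ∀ t → (fromℕ (suc m) - fromℕ t) + fromℕ n ≈ (fromℕ (suc m) + fromℕ n) + fromℕ t * - 1#
        progression t = trans (solve 3 (λ x y z → (x :- y) :+ z := (x :+ z) :- y) refl (fromℕ (suc m)) (fromℕ t) (fromℕ n))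
                              (+-congˡ (sym (x*-1≈-x (fromℕ t))))

      antidifferenceWeight-suc : ∀ n j →
        antidifferenceWeight n (suc j) ≈ antidifferenceWeight (suc n) j + sign (suc j) * choose (suc m) (suc j) * fromℕ n ^ m
      antidifferenceWeight-suc n j = +-cong
        (altSum-cong (suc m) (suc j) (λ t → ^-cong m
          (solve 4 (λ x y z o → ((x :+ o) :- y) :+ z := (x :- y) :+ (z :+ o)) refl (fromℕ j) (fromℕ t) (fromℕ n) 1#)))
        (*-congˡ (^-cong m (solve 2 (λ x z → (x :- x) :+ z := z) refl (fromℕ (suc j)) (fromℕ n))))

      antidifference-step : ∀ n → antidifference n ≈ fromℕ n ^ m * a n + antidifference (suc n)
      antidifference-step n = sym (begin
        N * a n + antidifference (suc n)
          ≈⟨ +-cong (*-congˡ a-n) next ⟩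
        N * (κ ^ suc m * (g 0 + Z)) + κ ^ suc m * ((X - N * g 0) - N * Z)
          ≈⟨ solve 5 (λ N K A Z X → N :* (K :* (A :+ Z)) :+ K :* ((X :- N :* A) :- N :* Z) := K :* X) refl N (κ ^ suc m) (g 0) Z X ⟩
        antidifference n ∎)
        where
        N : Carrier
        N = fromℕ n ^ m
        g : ℕ → Carrier
        g j = a (n +ℕ suc m +ℕ j)
        γ : ℕ → Carrier
        γ j = sign (suc j) * choose (suc m) (suc j)
        X Y Z : Carrier
        X = sumFirst (suc m) (λ j → antidifferenceWeight n j * g j)
        Y = sumFirst (suc m) (λ j → antidifferenceWeight n (suc j) * g (suc j))
        Z = sumFirst (suc m) (λ j → γ j * g (suc j))
        a-n : a n ≈ κ ^ suc m * (g 0 + Z)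
        a-n = trans (a≈κ^m*Δ (suc m) n)
                    (*-congˡ (trans (sumFirst-unfoldˡ (suc m) _) (+-congʳ (trans (*-congʳ (trans (*-identityˡ _) fromℕ-1)) (*-identityˡ _)))))
        Y≈X-Ng₀ : Y ≈ X - N * g 0
        Y≈X-Ng₀ = begin
          Y
            ≈⟨ solve 2 (λ y z → y := (z :+ y) :- z) refl Y (antidifferenceWeight n 0 * g 0) ⟩
          (antidifferenceWeight n 0 * g 0 + Y) - antidifferenceWeight n 0 * g 0
            ≈⟨ +-cong (sym (sumFirst-unfoldˡ (suc m) _)) (-‿cong (*-congʳ (antidifferenceWeight-0 n))) ⟩
          (X + antidifferenceWeight n (suc m) * g (suc m)) - N * g 0
            ≈⟨ +-congʳ (trans (+-congˡ (trans (*-congʳ (antidifferenceWeight-top n)) (zeroˡ _))) (+-identityʳ _)) ⟩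
          X - N * g 0 ∎
        term : ∀ j → antidifferenceWeight (suc n) j * a (suc n +ℕ suc m +ℕ j)
                       ≈ antidifferenceWeight n (suc j) * g (suc j) - N * (γ j * g (suc j))
        term j = begin
          antidifferenceWeight (suc n) j * a (suc n +ℕ suc m +ℕ j)
            ≈⟨ *-congʳ (solve 2 (λ x y → x := (x :+ y) :- y) refl _ (γ j * N)) ⟩
          (antidifferenceWeight (suc n) j + γ j * N - γ j * N) * a (suc n +ℕ suc m +ℕ j)
            ≈⟨ *-cong (+-congʳ (sym (antidifferenceWeight-suc n j))) (a-cong (P.sym (ℕP.+-suc (n +ℕ suc m) j))) ⟩
          (antidifferenceWeight n (suc j) - γ j * N) * g (suc j)
            ≈⟨ solve 4 (λ w c N g → (w :- c :* N) :* g := w :* g :- N :* (c :* g)) refl _ (γ j) N (g (suc j)) ⟩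
          antidifferenceWeight n (suc j) * g (suc j) - N * (γ j * g (suc j)) ∎
        next : antidifference (suc n) ≈ κ ^ suc m * ((X - N * g 0) - N * Z)
        next = *-congˡ (trans (sumFirst-cong (suc m) term)
                              (trans (sumFirst-- (suc m) _ _) (+-cong Y≈X-Ng₀ (-‿cong (sumFirst-*ˡ (suc m) N _)))))

      sum-telescopes : ∀ n → sumFirst n (λ k → fromℕ k ^ m * a k) ≈ antidifference 0 - antidifference n
      sum-telescopes zero    = sym (-‿inverseʳ _)
      sum-telescopes (suc n) = begin
        sumFirst n (λ k → fromℕ k ^ m * a k) + fromℕ n ^ m * a n
          ≈⟨ +-congʳ (trans (sum-telescopes n) (+-congˡ (-‿cong (antidifference-step n)))) ⟩
        (antidifference 0 - (fromℕ n ^ m * a n + antidifference (suc n))) + fromℕ n ^ m * a n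
          ≈⟨ solve 3 (λ g x h → (g :- (x :+ h)) :+ x := g :- h) refl (antidifference 0) (fromℕ n ^ m * a n) (antidifference (suc n)) ⟩
        antidifference 0 - antidifference (suc n) ∎

      antidifferenceWeight-binomial : ∀ n j →
        sumFirst (suc m) (λ s → choose m s * fromℕ n ^ (m ∸ s) * generalizedEulerian (suc m) s j) ≈ antidifferenceWeight n j
      antidifferenceWeight-binomial n j = begin
        sumFirst (suc m) (λ s → choose m s * fromℕ n ^ (m ∸ s) * altSum (suc m) (suc j) (λ t → x t ^ s))
          ≈⟨ sumFirst-cong (suc m) (λ s → sym (sumFirst-*ˡ (suc j) _ _)) ⟩
        sumFirst (suc m) (λ s → sumFirst (suc j) (λ t → choose m s * fromℕ n ^ (m ∸ s) * (sign t * choose (suc m) t * x t ^ s)))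
          ≈⟨ sumFirst-comm (suc m) (suc j) _ ⟩
        sumFirst (suc j) (λ t → sumFirst (suc m) (λ s → choose m s * fromℕ n ^ (m ∸ s) * (sign t * choose (suc m) t * x t ^ s)))
          ≈⟨ sumFirst-cong (suc j) (λ t → trans (sumFirst-cong (suc m) (λ s → regroup (choose m s) (fromℕ n ^ (m ∸ s)) (sign t * choose (suc m) t) (x t ^ s)))
                                                (sumFirst-*ˡ (suc m) _ _)) ⟩
        sumFirst (suc j) (λ t → sign t * choose (suc m) t * sumFirst (suc m) (λ s → choose m s * (x t ^ s * fromℕ n ^ (m ∸ s))))
          ≈⟨ altSum-cong (suc m) (suc j) (λ t → sym (binomial m (x t) (fromℕ n))) ⟩
        antidifferenceWeight n j ∎
        where
        x : ℕ → Carrier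
        x t = fromℕ j - fromℕ t
        regroup : ∀ c p w y → c * p * (w * y) ≈ w * (c * (y * p))
        regroup = solve 4 (λ c p w y → (c :* p) :* (w :* y) := w :* (c :* (y :* p))) refl

      antidifference-expansion : ∀ n →
        antidifference n ≈ sumFirst (suc m) (λ s → choose m s * fromℕ n ^ (m ∸ s) * eulerianTail (suc s) s n)
      antidifference-expansion n = sym (begin
        sumFirst (suc m) (λ s → C s * eulerianTail (suc s) s n)
          ≈⟨ sumFirst-cong< (suc m) (λ s s<1+m → *-congˡ (sym (tail-at-top s s<1+m))) ⟩
        sumFirst (suc m) (λ s → C s * (κ ^ suc m * sumFirst (suc m) (λ j → generalizedEulerian (suc m) s j * g j)))
          ≈⟨ sumFirst-cong (suc m) (λ s → trans (solve 3 (λ x k S → x :* (k :* S) := k :* (x :* S)) refl (C s) (κ ^ suc m) _)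
                                                (*-congˡ (sym (sumFirst-*ˡ (suc m) _ _)))) ⟩
        sumFirst (suc m) (λ s → κ ^ suc m * sumFirst (suc m) (λ j → C s * (generalizedEulerian (suc m) s j * g j)))
          ≈⟨ trans (sumFirst-*ˡ (suc m) _ _) (*-congˡ (sumFirst-comm (suc m) (suc m) _)) ⟩
        κ ^ suc m * sumFirst (suc m) (λ j → sumFirst (suc m) (λ s → C s * (generalizedEulerian (suc m) s j * g j)))
          ≈⟨ *-congˡ (sumFirst-cong (suc m) (λ j → trans (sumFirst-cong (suc m) (λ s → sym (*-assoc _ _ _)))
                                                     (trans (sumFirst-*ʳ (suc m) _ _) (*-congʳ (antidifferenceWeight-binomial n j))))) ⟩
        antidifference n ∎)
        where
        C : ℕ → Carrier
        C s = choose m s * fromℕ n ^ (m ∸ s)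
        g : ℕ → Carrier
        g j = a (n +ℕ suc m +ℕ j)
        tail-at-top : ∀ s → s < suc m → eulerianTail (suc m) s n ≈ eulerianTail (suc s) s n
        tail-at-top s (s≤s s≤m) =
          trans (≡⇒≈ (P.cong (λ l → eulerianTail l s n) (P.sym (P.trans (ℕP.+-suc (m ∸ s) s) (P.cong suc (ℕP.m∸n+n≡m s≤m))))))
                (eulerianTail-stable (m ∸ s) s n)

      antidifference-0 : antidifference 0 ≈ eulerianTail (suc m) m 0
      antidifference-0 = *-congˡ (sumFirst-cong (suc m) (λ j → *-congʳ (altSum-cong (suc m) (suc j) (λ t → ^-cong m (+-identityʳ _)))))

      antidifference-suc-expansion : ∀ n → antidifference (suc n) ≈
        fromℕ n ^ m * (κ * a (suc (suc n)))
          + sumFirst m (λ s → choose m (suc s) * fromℕ n ^ (m ∸ suc s) * eulerianTail (suc (suc s)) (suc s) n)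
      antidifference-suc-expansion n = begin
        antidifference (suc n)
          ≈⟨ solve 2 (λ h x → h := (x :+ h) :- x) refl (antidifference (suc n)) (N * a n) ⟩
        (N * a n + antidifference (suc n)) - N * a n
          ≈⟨ +-cong (sym (antidifference-step n)) (-‿cong (*-congˡ (a-rec n))) ⟩
        antidifference n - N * (κ * (a (suc n) - a (suc (suc n))))
          ≈⟨ +-congʳ (trans (antidifference-expansion n) (sumFirst-unfoldˡ m _)) ⟩
        (choose m 0 * N * eulerianTail 1 0 n + S) - N * (κ * (a (suc n) - a (suc (suc n))))
          ≈⟨ +-congʳ (+-congʳ (*-cong (trans (*-congʳ fromℕ-1) (*-identityˡ N)) (eulerianTail-1-0 n))) ⟩
        (N * (κ * a (suc n)) + S) - N * (κ * (a (suc n) - a (suc (suc n))))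
          ≈⟨ solve 5 (λ N k x y S → (N :* (k :* x) :+ S) :- N :* (k :* (x :- y)) := N :* (k :* y) :+ S)
                   refl N κ (a (suc n)) (a (suc (suc n))) S ⟩
        N * (κ * a (suc (suc n))) + S ∎
        where
        N S : Carrier
        N = fromℕ n ^ m
        S = sumFirst m (λ s → choose m (suc s) * fromℕ n ^ (m ∸ suc s) * eulerianTail (suc (suc s)) (suc s) n)

      sum-formula : ∀ n → sumFirst n (λ i → fromℕ (suc i) ^ m * a (suc i)) ≈
        ((- (a 0 * δ0 m) - fromℕ n ^ m * (κ * a (suc (suc n)))) + eulerianTail (suc m) m 0)
          - sumFirst m (λ s → choose m (suc s) * fromℕ n ^ (m ∸ suc s) * eulerianTail (suc (suc s)) (suc s) n)
      sum-formula n = begin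
        L                                            ≈⟨ solve 2 (λ l f → l := (f :+ l) :- f) refl L (fromℕ 0 ^ m * a 0) ⟩
        (fromℕ 0 ^ m * a 0 + L) - fromℕ 0 ^ m * a 0  ≈⟨ +-cong (sym (sumFirst-unfoldˡ n _)) (-‿cong (0^m*x≈x*δ0 m (a 0))) ⟩
        sumFirst (suc n) (λ k → fromℕ k ^ m * a k) - a 0 * δ0 m
          ≈⟨ +-congʳ (trans (sum-telescopes (suc n)) (+-cong antidifference-0 (-‿cong (antidifference-suc-expansion n)))) ⟩
        (eulerianTail (suc m) m 0 - (T + S)) - a 0 * δ0 m
          ≈⟨ solve 4 (λ E T S A → (E :- (T :+ S)) :- A := (((:- A) :- T) :+ E) :- S) refl (eulerianTail (suc m) m 0) T S (a 0 * δ0 m) ⟩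
        ((- (a 0 * δ0 m) - T) + eulerianTail (suc m) m 0) - S ∎
        where
        L T S : Carrier
        L = sumFirst n (λ i → fromℕ (suc i) ^ m * a (suc i))
        T = fromℕ n ^ m * (κ * a (suc (suc n)))
        S = sumFirst m (λ s → choose m (suc s) * fromℕ n ^ (m ∸ suc s) * eulerianTail (suc (suc s)) (suc s) n)

module HoradamProperties {c ℓ : Level} (F : Field c ℓ) where
  open Field F
  open Horadam F
  open Arithmetic F
  open FiniteDifferences F

  module Recurrence (a b p q : Carrier) (q≢0 : ¬ (q ≈ 0#)) where

    W : ℤ → Carrier
    W = w a b p q

    W-cong : ∀ {i j} → i P.≡ j → W i ≈ W j
    W-cong i≡j = ≡⇒≈ (P.cong W i≡j)

    backward-step : ∀ x y → y ≈ p * x - q * ((p * x - y) * q ⁻¹)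
    backward-step x y = sym (begin
      p * x - q * ((p * x - y) * q ⁻¹)  ≈⟨ +-congˡ (-‿cong (x*[y*z]≈y*[x*z] q (p * x - y) (q ⁻¹))) ⟩
      p * x - (p * x - y) * (q * q ⁻¹)  ≈⟨ +-congˡ (-‿cong (trans (*-congˡ (inverseʳ q q≢0)) (*-identityʳ _))) ⟩
      p * x - (p * x - y)               ≈⟨ solve 2 (λ z y → z :- (z :- y) := y) refl (p * x) y ⟩
      y                                 ∎)

    W-rec : ∀ i → W (i +ℤ + 2) ≈ p * W (i +ℤ + 1) - q * W i
    W-rec (+ n)                  = trans (W-cong (P.cong +_ (ℕP.+-comm n 2)))
                                         (sym (+-congʳ (*-congˡ (W-cong (P.cong +_ (ℕP.+-comm n 1))))))
    W-rec -[1+ zero ]            = backward-step a b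
    W-rec -[1+ suc zero ]        = backward-step (W -[1+ 0 ]) a
    W-rec -[1+ suc (suc k) ]     = backward-step (W -[1+ suc k ]) (W -[1+ k ])

    W-+-assoc : ∀ i x y → W ((i +ℤ + x) +ℤ + y) ≈ W (i +ℤ + (x +ℕ y))
    W-+-assoc i x y = W-cong (P.trans (ℤP.+-assoc i (+ x) (+ y)) (P.cong (i +ℤ_) (P.sym (ℤP.pos-+ x y))))

    W-+-cong : ∀ i {x y} → x P.≡ y → W (i +ℤ + x) ≈ W (i +ℤ + y)
    W-+-cong i x≡y = W-cong (P.cong (λ x → i +ℤ + x) x≡y)

    V*W≈W+q^k*W : ∀ k i → V p q (+ k) * W (i +ℤ + k) ≈ W (i +ℤ + (k +ℕ k)) + q ^ k * W i
    V*W≈W+q^k*W 0 i = begin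
      (1# + 1#) * W (i +ℤ + 0)     ≈⟨ trans (distribʳ _ _ _) (+-congʳ (*-identityˡ _)) ⟩
      W (i +ℤ + 0) + 1# * W (i +ℤ + 0) ≈⟨ +-congˡ (*-congˡ (W-cong (ℤP.+-identityʳ i))) ⟩
      W (i +ℤ + 0) + 1# * W i      ∎
    V*W≈W+q^k*W 1 i = begin
      p * W (i +ℤ + 1)                            ≈⟨ solve 2 (λ x y → x := (x :- y) :+ y) refl (p * W (i +ℤ + 1)) (q * W i) ⟩
      (p * W (i +ℤ + 1) - q * W i) + q * W i      ≈⟨ +-cong (sym (W-rec i)) (*-congʳ (sym (*-identityˡ q))) ⟩
      W (i +ℤ + 2) + (1# * q) * W i               ∎
    V*W≈W+q^k*W (suc (suc k)) i = begin
      (p * V p q (+ suc k) - q * V p q (+ k)) * W (i +ℤ + suc (suc k))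
        ≈⟨ solve 5 (λ p V₁ q V₀ T → (p :* V₁ :- q :* V₀) :* T := p :* (V₁ :* T) :- q :* (V₀ :* T))
                 refl p (V p q (+ suc k)) q (V p q (+ k)) (W (i +ℤ + suc (suc k))) ⟩
      p * (V p q (+ suc k) * W (i +ℤ + suc (suc k))) - q * (V p q (+ k) * W (i +ℤ + suc (suc k)))
        ≈⟨ +-cong (*-congˡ (trans (*-congˡ (sym (W-+-assoc i 1 (suc k)))) (V*W≈W+q^k*W (suc k) (i +ℤ + 1))))
                  (-‿cong (*-congˡ (trans (*-congˡ (sym (W-+-assoc i 2 k))) (V*W≈W+q^k*W k (i +ℤ + 2))))) ⟩
      p * (W ((i +ℤ + 1) +ℤ + (suc k +ℕ suc k)) + q ^ suc k * W (i +ℤ + 1))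
        - q * (W ((i +ℤ + 2) +ℤ + (k +ℕ k)) + q ^ k * W (i +ℤ + 2))
        ≈⟨ +-cong (*-congˡ (+-congʳ (trans (W-+-assoc i 1 _) (trans (W-+-cong i (ℕP.+-comm 1 (suc k +ℕ suc k))) (sym (W-+-assoc i _ 1))))))
                  (-‿cong (*-congˡ (+-cong (trans (W-+-assoc i 2 _) (W-+-cong i (P.cong suc (P.sym (ℕP.+-suc k k))))) (*-congˡ (W-rec i))))) ⟩
      p * (W (j +ℤ + 1) + q ^ suc k * W (i +ℤ + 1)) - q * (W j + q ^ k * (p * W (i +ℤ + 1) - q * W i))
        ≈⟨ solve 7 (λ p q A B X Y Q → p :* (A :+ (Q :* q) :* X) :- q :* (B :+ Q :* (p :* X :- q :* Y))
                                        := (p :* A :- q :* B) :+ ((Q :* q) :* q) :* Y)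
                 refl p q (W (j +ℤ + 1)) (W j) (W (i +ℤ + 1)) (W i) (q ^ k) ⟩
      (p * W (j +ℤ + 1) - q * W j) + q ^ suc (suc k) * W i
        ≈⟨ +-congʳ (trans (sym (W-rec j)) (trans (W-+-assoc i _ 2) (W-+-cong i (index k)))) ⟩
      W (i +ℤ + (suc (suc k) +ℕ suc (suc k))) + q ^ suc (suc k) * W i ∎
      where
      j : ℤ
      j = i +ℤ + (suc k +ℕ suc k)
      index : ∀ k → (suc k +ℕ suc k) +ℕ 2 P.≡ suc (suc k) +ℕ suc (suc k)
      index = ℕ-Solver.solve-∀

    W-subsequence-rec : ∀ h r k →
      W (+ (h *ℕ suc (suc k)) +ℤ r) ≈ V p q (+ h) * W (+ (h *ℕ suc k) +ℤ r) - q ^ h * W (+ (h *ℕ k) +ℤ r)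
    W-subsequence-rec h r k = begin
      W (+ (h *ℕ suc (suc k)) +ℤ r)                     ≈⟨ W-cong (P.sym (shift (h *ℕ k) (h +ℕ h) (index₂ h k))) ⟩
      W (i +ℤ + (h +ℕ h))                               ≈⟨ solve 2 (λ x y → x := (x :+ y) :- y) refl _ (q ^ h * W i) ⟩
      (W (i +ℤ + (h +ℕ h)) + q ^ h * W i) - q ^ h * W i ≈⟨ +-congʳ (sym (V*W≈W+q^k*W h i)) ⟩
      V p q (+ h) * W (i +ℤ + h) - q ^ h * W i          ≈⟨ +-congʳ (*-congˡ (W-cong (shift (h *ℕ k) h (index₁ h k)))) ⟩
      V p q (+ h) * W (+ (h *ℕ suc k) +ℤ r) - q ^ h * W i ∎
      where
      i : ℤ
      i = + (h *ℕ k) +ℤ r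
      shift : ∀ x y {z} → x +ℕ y P.≡ z → (+ x +ℤ r) +ℤ + y P.≡ + z +ℤ r
      shift x y P.refl = P.trans (ℤP.+-assoc (+ x) r (+ y))
        (P.trans (P.cong (+ x +ℤ_) (ℤP.+-comm r (+ y))) (P.sym (P.trans (P.cong (_+ℤ r) (ℤP.pos-+ x y)) (ℤP.+-assoc (+ x) (+ y) r))))
      index₁ : ∀ h k → h *ℕ k +ℕ h P.≡ h *ℕ suc k
      index₁ = ℕ-Solver.solve-∀
      index₂ : ∀ h k → h *ℕ k +ℕ (h +ℕ h) P.≡ h *ℕ suc (suc k)
      index₂ = ℕ-Solver.solve-∀

  module Subsequence (a b p q : Carrier) (q≢0 : ¬ (q ≈ 0#)) (h : ℕ) (r : ℤ) (Vh≢0 : ¬ (V p q (+ h) ≈ 0#)) where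
    open Recurrence a b p q q≢0

    Vh Q κ : Carrier
    Vh = V p q (+ h)
    Q  = q ^ h
    κ  = Vh * Vh * Q ⁻¹

    Q≢0 : ¬ (Q ≈ 0#)
    Q≢0 = ^-≢0 q≢0 h

    u : ℕ → Carrier
    u k = W (+ (h *ℕ k) +ℤ r)

    normalized : ℕ → Carrier
    normalized k = u k * (Vh ⁻¹) ^ k

    Vh*Vh⁻¹*x≈x : ∀ x → Vh * Vh ⁻¹ * x ≈ x
    Vh*Vh⁻¹*x≈x x = trans (*-congʳ (inverseʳ Vh Vh≢0)) (*-identityˡ x)

    -- The ring identity keeps the factors Vh Vh⁻¹ and Q Q⁻¹, which are cancelled afterwards.
    normalized-rec : ∀ k → normalized k ≈ κ * (normalized (suc k) - normalized (suc (suc k)))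
    normalized-rec k = sym (begin
      κ * (u (suc k) * (I * Vh ⁻¹) - u (suc (suc k)) * (I * Vh ⁻¹ * Vh ⁻¹))
        ≈⟨ *-congˡ (+-congˡ (-‿cong (*-congʳ (W-subsequence-rec h r k)))) ⟩
      κ * (u (suc k) * (I * Vh ⁻¹) - (Vh * u (suc k) - Q * u k) * (I * Vh ⁻¹ * Vh ⁻¹))
        ≈⟨ solve 7 (λ V v Q q u₁ u₀ I →
                      (V :* V :* q) :* (u₁ :* (I :* v) :- (V :* u₁ :- Q :* u₀) :* (I :* v :* v))
                   := (V :* v :* (V :* (q :* (u₁ :* I))) :- V :* v :* (V :* v :* (V :* (q :* (u₁ :* I)))))
                      :+ V :* v :* (V :* v :* (Q :* q :* (u₀ :* I))))
                 refl Vh (Vh ⁻¹) Q (Q ⁻¹) (u (suc k)) (u k) I ⟩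
      (Vh * Vh ⁻¹ * Y - Vh * Vh ⁻¹ * (Vh * Vh ⁻¹ * Y)) + Vh * Vh ⁻¹ * (Vh * Vh ⁻¹ * (Q * Q ⁻¹ * (u k * I)))
        ≈⟨ +-cong (+-congˡ (-‿cong (Vh*Vh⁻¹*x≈x _)))
                  (trans (Vh*Vh⁻¹*x≈x _) (trans (Vh*Vh⁻¹*x≈x _) (trans (*-congʳ (inverseʳ Q Q≢0)) (*-identityˡ _)))) ⟩
      (Vh * Vh ⁻¹ * Y - Vh * Vh ⁻¹ * Y) + u k * I
        ≈⟨ trans (+-congʳ (-‿inverseʳ _)) (+-identityˡ _) ⟩
      normalized k ∎)
      where
      I Y : Carrier
      I = (Vh ⁻¹) ^ k
      Y = Vh * (Q ⁻¹ * (u (suc k) * I))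

    open SecondOrderRecurrence F
    open Sums κ normalized normalized-rec public

    κ^k*Vh⁻¹^k : ∀ k → κ ^ k * (Vh ⁻¹) ^ k ≈ (Vh * Q ⁻¹) ^ k
    κ^k*Vh⁻¹^k k = trans (sym (^-distribʳ-* κ (Vh ⁻¹) k)) (^-cong k κ*Vh⁻¹)
      where
      κ*Vh⁻¹ : κ * Vh ⁻¹ ≈ Vh * Q ⁻¹
      κ*Vh⁻¹ = trans (solve 3 (λ V q v → V :* V :* q :* v := V :* v :* (V :* q)) refl Vh (Q ⁻¹) (Vh ⁻¹)) (Vh*Vh⁻¹*x≈x _)

    eulerianTail-unnormalized : ∀ k s n → eulerianTail k s n ≈
      (Vh * Q ⁻¹) ^ k * sumFirst k (λ j → generalizedEulerian k s j * u (n +ℕ k +ℕ j) * (Vh ⁻¹) ^ (n +ℕ j))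
    eulerianTail-unnormalized k s n = begin
      κ ^ k * sumFirst k (λ j → E j * (u (n +ℕ k +ℕ j) * (Vh ⁻¹) ^ (n +ℕ k +ℕ j)))
        ≈⟨ *-congˡ (trans (sumFirst-cong k term) (sumFirst-*ˡ k _ _)) ⟩
      κ ^ k * ((Vh ⁻¹) ^ k * sumFirst k (λ j → E j * u (n +ℕ k +ℕ j) * (Vh ⁻¹) ^ (n +ℕ j)))
        ≈⟨ trans (sym (*-assoc _ _ _)) (*-congʳ (κ^k*Vh⁻¹^k k)) ⟩
      (Vh * Q ⁻¹) ^ k * sumFirst k (λ j → E j * u (n +ℕ k +ℕ j) * (Vh ⁻¹) ^ (n +ℕ j)) ∎
      where
      E : ℕ → Carrier
      E j = generalizedEulerian k s j
      index : ∀ n k j → n +ℕ k +ℕ j P.≡ k +ℕ (n +ℕ j)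
      index = ℕ-Solver.solve-∀
      term : ∀ j → E j * (u (n +ℕ k +ℕ j) * (Vh ⁻¹) ^ (n +ℕ k +ℕ j)) ≈ (Vh ⁻¹) ^ k * (E j * u (n +ℕ k +ℕ j) * (Vh ⁻¹) ^ (n +ℕ j))
      term j = begin
        E j * (u (n +ℕ k +ℕ j) * (Vh ⁻¹) ^ (n +ℕ k +ℕ j))
          ≈⟨ *-congˡ (*-congˡ (trans (≡⇒≈ (P.cong ((Vh ⁻¹) ^_) (index n k j))) (^-distribˡ-+-* (Vh ⁻¹) k (n +ℕ j)))) ⟩
        E j * (u (n +ℕ k +ℕ j) * ((Vh ⁻¹) ^ k * (Vh ⁻¹) ^ (n +ℕ j)))
          ≈⟨ solve 4 (λ e x v w → e :* (x :* (v :* w)) := v :* (e :* x :* w)) refl (E j) _ _ _ ⟩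
        (Vh ⁻¹) ^ k * (E j * u (n +ℕ k +ℕ j) * (Vh ⁻¹) ^ (n +ℕ j)) ∎

    normalized-0 : normalized 0 ≈ W r
    normalized-0 = trans (*-identityʳ _) (W-cong (P.trans (P.cong (λ z → + z +ℤ r) (ℕP.*-zeroʳ h)) (ℤP.+-identityˡ r)))

    boundary-term : ∀ n → κ * normalized (suc (suc n)) ≈ W (+ (h *ℕ (n +ℕ 2)) +ℤ r) * (Q * Vh ^ n) ⁻¹
    boundary-term n = sym (begin
      W (+ (h *ℕ (n +ℕ 2)) +ℤ r) * (Q * Vh ^ n) ⁻¹
        ≈⟨ *-cong (W-cong (P.cong (λ z → + (h *ℕ z) +ℤ r) (ℕP.+-comm n 2))) (trans (⁻¹-* Q≢0 (^-≢0 Vh≢0 n)) (*-congˡ (⁻¹-^ Vh≢0 n))) ⟩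
      u (suc (suc n)) * (Q ⁻¹ * (Vh ⁻¹) ^ n)
        ≈⟨ sym (trans (Vh*Vh⁻¹*x≈x _) (Vh*Vh⁻¹*x≈x _)) ⟩
      Vh * Vh ⁻¹ * (Vh * Vh ⁻¹ * (u (suc (suc n)) * (Q ⁻¹ * (Vh ⁻¹) ^ n)))
        ≈⟨ solve 5 (λ V v q x I → V :* v :* (V :* v :* (x :* (q :* I))) := V :* V :* q :* (x :* (I :* v :* v)))
                 refl Vh (Vh ⁻¹) (Q ⁻¹) (u (suc (suc n))) ((Vh ⁻¹) ^ n) ⟩
      κ * normalized (suc (suc n)) ∎)

    eulerianTail-main : ∀ m → eulerianTail (suc m) m 0 ≈
      (Vh * Q ⁻¹) ^ suc m * sumFromTo 0 m (λ j → fromℤ (Eulerian m j) * W (+ (h *ℕ (j +ℕ m +ℕ 1)) +ℤ r) * (Vh ^ j) ⁻¹)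
    eulerianTail-main m = trans (eulerianTail-unnormalized (suc m) m 0) (*-congˡ (sumFirst-cong (suc m) (λ j →
      *-cong (*-cong (sym (fromℤ-Eulerian m j)) (W-cong (P.cong (λ z → + (h *ℕ z) +ℤ r) (index m j)))) (sym (⁻¹-^ Vh≢0 j)))))
      where
      index : ∀ m j → suc m +ℕ j P.≡ j +ℕ m +ℕ 1
      index = ℕ-Solver.solve-∀

    eulerianTail-remainder : ∀ s n → eulerianTail (suc (suc s)) (suc s) n ≈
      (q ^ (h *ℕ (suc s +ℕ 1))) ⁻¹
        * sumFromTo 1 (suc s) (λ j → fromℤ (Eulerian (suc s) j) * W (+ (h *ℕ (j +ℕ n +ℕ suc s +ℕ 1)) +ℤ r)
            * (Vh ^ℤ (+ (j +ℕ n) -ℤ + (suc s +ℕ 1))) ⁻¹)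
    eulerianTail-remainder s n = begin
      eulerianTail K (suc s) n
        ≈⟨ eulerianTail-unnormalized K (suc s) n ⟩
      (Vh * Q ⁻¹) ^ K * sumFirst K (λ j → E j * u (n +ℕ K +ℕ j) * (Vh ⁻¹) ^ (n +ℕ j))
        ≈⟨ *-congˡ (trans (sumFirst-unfoldˡ (suc s) _) (trans (+-congʳ first≈0) (+-identityˡ _))) ⟩
      (Vh * Q ⁻¹) ^ K * sumFirst (suc s) (λ j → X j * (Vh ⁻¹) ^ (n +ℕ suc j))
        ≈⟨ trans (*-congʳ (trans (^-distribʳ-* Vh (Q ⁻¹) K) (*-comm _ _))) (*-assoc _ _ _) ⟩
      (Q ⁻¹) ^ K * (Vh ^ K * sumFirst (suc s) (λ j → X j * (Vh ⁻¹) ^ (n +ℕ suc j)))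
        ≈⟨ *-congˡ (trans (sym (sumFirst-*ˡ (suc s) _ _)) (sumFirst-cong (suc s) (λ j → x*[y*z]≈y*[x*z] (Vh ^ K) (X j) _))) ⟩
      (Q ⁻¹) ^ K * sumFirst (suc s) (λ j → X j * (Vh ^ K * (Vh ⁻¹) ^ (n +ℕ suc j)))
        ≈⟨ *-cong (sym Q⁻¹^K) (sumFirst-cong (suc s) term) ⟩
      (q ^ (h *ℕ (suc s +ℕ 1))) ⁻¹ * sumFirst (suc s) (λ j → fromℤ (Eulerian (suc s) (suc j)) * W (+ (h *ℕ (suc j +ℕ n +ℕ suc s +ℕ 1)) +ℤ r)
          * (Vh ^ℤ (+ (suc j +ℕ n) -ℤ + (suc s +ℕ 1))) ⁻¹) ∎
      where
      K : ℕ
      K = suc (suc s)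
      E : ℕ → Carrier
      E j = generalizedEulerian K (suc s) j
      X : ℕ → Carrier
      X j = E (suc j) * u (n +ℕ K +ℕ suc j)
      first≈0 : E 0 * u (n +ℕ K +ℕ 0) * (Vh ⁻¹) ^ (n +ℕ 0) ≈ 0#
      first≈0 = trans (*-congʳ (trans (*-congʳ (generalizedEulerian-at-0 K s)) (zeroˡ _))) (zeroˡ _)
      K≡ : suc s +ℕ 1 P.≡ K
      K≡ = P.cong suc (ℕP.+-comm s 1)
      Q⁻¹^K : (q ^ (h *ℕ (suc s +ℕ 1))) ⁻¹ ≈ (Q ⁻¹) ^ K
      Q⁻¹^K = trans (⁻¹-cong (trans (^-*-assoc q h (suc s +ℕ 1)) (≡⇒≈ (P.cong (Q ^_) K≡))) (^-≢0 Q≢0 K)) (⁻¹-^ Q≢0 K)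
      index : ∀ n s j → n +ℕ suc (suc s) +ℕ suc j P.≡ suc j +ℕ n +ℕ suc s +ℕ 1
      index = ℕ-Solver.solve-∀
      term : ∀ j → X j * (Vh ^ K * (Vh ⁻¹) ^ (n +ℕ suc j))
                 ≈ fromℤ (Eulerian (suc s) (suc j)) * W (+ (h *ℕ (suc j +ℕ n +ℕ suc s +ℕ 1)) +ℤ r) * (Vh ^ℤ (+ (suc j +ℕ n) -ℤ + (suc s +ℕ 1))) ⁻¹
      term j = *-cong (*-cong (sym (fromℤ-Eulerian (suc s) (suc j))) (W-cong (P.cong (λ z → + (h *ℕ z) +ℤ r) (index n s j))))
        (sym (trans (⁻¹-^ℤ-⊖ Vh≢0 (suc j +ℕ n) (suc s +ℕ 1))
                    (*-cong (≡⇒≈ (P.cong (Vh ^_) K≡)) (≡⇒≈ (P.cong ((Vh ⁻¹) ^_) (ℕP.+-comm (suc j) n))))))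

    summand-normalized : ∀ x k → x * u k * (Vh ^ k) ⁻¹ ≈ x * normalized k
    summand-normalized x k = trans (*-assoc _ _ _) (*-congˡ (*-congˡ (⁻¹-^ Vh≢0 k)))

theorem6 : ∀ {c ℓ : Level} (F : Field c ℓ) → let open Field F in let open Horadam F in
  (a b p q : Carrier) → ¬ (p ≈ 0#) → ¬ (q ≈ 0#) → ¬ (p ≈ q + 1#) →
  (m n h : ℕ) (r : ℤ) → ¬ (V p q (+ h) ≈ 0#) →
  let Vh = V p q (+ h)
      W  = w a b p q
  in sumFromTo 1 n (λ k → (fromℕ k ^ m) * W (+ (h *ℕ k) +ℤ r) * ((Vh ^ k) ⁻¹))
     ≈ ((((- (W r * δ0 m))
          - ((fromℕ n ^ m) * W (+ (h *ℕ (n +ℕ 2)) +ℤ r) * (((q ^ h) * (Vh ^ n)) ⁻¹)))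
         + (((Vh * ((q ^ h) ⁻¹)) ^ suc m)
            * sumFromTo 0 m (λ j → fromℤ (Eulerian m j) * W (+ (h *ℕ (j +ℕ m +ℕ 1)) +ℤ r) * ((Vh ^ j) ⁻¹))))
        - sumFromTo 1 m (λ s → fromℕ (m C s) * (fromℕ n ^ (m ∸ s)) * ((q ^ (h *ℕ (s +ℕ 1))) ⁻¹)
            * sumFromTo 1 s (λ j → fromℤ (Eulerian s j) * W (+ (h *ℕ (j +ℕ n +ℕ s +ℕ 1)) +ℤ r)
                * ((Vh ^ℤ ((+ (j +ℕ n)) -ℤ (+ (s +ℕ 1)))) ⁻¹))))
theorem6 F a b p q _ q≢0 _ m n h r Vh≢0 = begin
  _ ≈⟨ sumFirst-cong n (λ i → summand-normalized (fromℕ (suc i) ^ m) (suc i)) ⟩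
  sumFirst n (λ i → fromℕ (suc i) ^ m * normalized (suc i))
    ≈⟨ sum-formula n ⟩
  ((- (normalized 0 * δ0 m) - fromℕ n ^ m * (κ * normalized (suc (suc n)))) + eulerianTail (suc m) m 0)
    - sumFirst m (λ s → choose m (suc s) * fromℕ n ^ (m ∸ suc s) * eulerianTail (suc (suc s)) (suc s) n)
    ≈⟨ +-cong (+-cong (+-cong (-‿cong (*-congʳ normalized-0))
                              (-‿cong (trans (*-congˡ (boundary-term n)) (sym (*-assoc _ _ _)))))
                      (eulerianTail-main m))
              (-‿cong (sumFirst-cong m (λ s → trans (*-congˡ (eulerianTail-remainder s n)) (sym (*-assoc _ _ _))))) ⟩
  _ ∎
  where
  open Field F
  open Horadam F
  open Arithmetic F
  open FiniteDifferences F
  open HoradamProperties F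
  open Subsequence a b p q q≢0 h r Vh≢0
  open PowerWeightedSums m
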